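{- Let $G$ be a graph and let $G'$ be the graph obtained by 3-subdividing every edge of $G$. Then $G$ is a yes-instance of 1-Edge Contraction($\gamma$) if and only if $G'$ is a yes-instance of 1-Edge Contraction($\gamma$).
   Context: All graphs are finite, undirected, simple and connected. The 3-subdivision of an edge $uv$ replaces it by a path $u$-$v_1$-$v_2$-$v_3$-$v$ where $v_1,v_2,v_3$ are new vertices. The domination number $\gamma(G)$ is the minimum size of a set $D\subseteq V(G)$ such that every vertex outside $D$ has a neighbor in $D$. The contraction of an edge $uv$ removes $u$ and $v$ and replaces them by a new vertex adjacent to exactly those vertices that were adjacent to $u$ or $v$ (no loops or multiple edges are created). The problem 1-Edge Contraction($\gamma$) is: given a connected graph $G$, decide whether $G$ can be transformed by at most one edge contraction into a graph $G''$ with $\gamma(G'')\leq\gamma(G)-1$. -}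

module Defs where

open import Data.Nat using (ℕ; _≤_; _<_; suc; _+_)
open import Data.Fin using (Fin; toℕ)
import Data.Fin as Fin
open import Data.Bool using (Bool; true; false; T)
open import Data.List using (List; length)
open import Data.List.Membership.Propositional using (_∈_)
open import Data.Product using (Σ; ∃; ∃-syntax; _×_; _,_)
open import Data.Sum using (_⊎_; inj₁; inj₂)
open import Data.Empty using (⊥)
open import Relation.Nullary using (¬_)
open import Relation.Binary.PropositionalEquality using (_≡_; _≢_)

record Graph : Set₁ where
  field
    V     : Set
    Adj   : V → V → Set
    sym   : ∀ {x y} → Adj x y → Adj y x
    irrefl : ∀ {x} → ¬ Adj x x
open Graph public

data Walk (G : Graph) : V G → V G → Set where
  here : ∀ {x} → Walk G x x
  step : ∀ {x y z} → Adj G x y → Walk G y z → Walk G x z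

Connected : Graph → Set
Connected G = ∀ x y → Walk G x y

Dominating : (G : Graph) → List (V G) → Set
Dominating G D = ∀ v → v ∈ D ⊎ (∃[ w ] (w ∈ D × Adj G v w))

-- γ(G) = k : some dominating set of size k exists and none is smaller.
-- (Sets are represented as lists; duplicates only increase the length,
-- so the minimum length of a dominating list is the domination number.)
DomNum : Graph → ℕ → Set
DomNum G k =
  (∃[ D ] (Dominating G D × length D ≡ k)) ×
  (∀ D → Dominating G D → k ≤ length D)

-- Edge contraction, described up to isomorphism:
-- H is the contraction of the edge xy of G via the quotient map f
-- when f is surjective, identifies exactly x and y, and two distinct
-- vertices of H are adjacent iff some preimages are adjacent in G.

record IsContraction (G : Graph) (x y : V G) (H : Graph)
                     (f : V G → V H) : Set where
  field
    surj     : ∀ b → ∃[ a ] (f a ≡ b)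
    merge    : f x ≡ f y
    onlyxy   : ∀ a b → f a ≡ f b →
               a ≡ b ⊎ ((a ≡ x ⊎ a ≡ y) × (b ≡ x ⊎ b ≡ y))
    adj→     : ∀ p q → Adj H p q →
               p ≢ q × (∃[ a ] ∃[ b ] (f a ≡ p × f b ≡ q × Adj G a b))
    adj←     : ∀ p q → p ≢ q →
               (∃[ a ] ∃[ b ] (f a ≡ p × f b ≡ q × Adj G a b)) → Adj H p q

-- 1-Edge Contraction(γ): at most one contraction decreases γ by at least 1.
YesInstance : Graph → Set₁
YesInstance G =
  -- zero contractions
  (∃[ k ] (DomNum G k × suc k ≤ k)) ⊎
  (∃[ x ] ∃[ y ] (Adj G x y ×
     Σ Graph λ H → Σ (V G → V H) λ f → IsContraction G x y H f ×
       (∃[ k ] ∃[ k' ] (DomNum G k × DomNum H k' × k' + 1 ≤ k))))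

record FinGraph (n : ℕ) : Set where
  field
    adj      : Fin n → Fin n → Bool
    adj-sym  : ∀ u v → adj u v ≡ adj v u
    adj-irr  : ∀ u → adj u u ≡ false
open FinGraph public

toGraph : ∀ {n} → FinGraph n → Graph
toGraph {n} G = record
  { V = Fin n
  ; Adj = λ u v → T (adj G u v)
  ; sym = λ {u} {v} p → subst' (adj-sym G u v) p
  ; irrefl = λ {u} p → noT (adj-irr G u) p
  }
  where
  subst' : ∀ {a b : Bool} → a ≡ b → T a → T b
  subst' _≡_.refl t = t
  noT : ∀ {a : Bool} → a ≡ false → T a → ⊥
  noT _≡_.refl ()

-- Each edge {u,v} is represented once, as (u , v) with toℕ u < toℕ v
-- (both proof components are proof-irrelevant), and gets three new
-- vertices (e , 0), (e , 1), (e , 2) on the path u - e0 - e1 - e2 - v.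

record Edge {n} (G : FinGraph n) : Set where
  constructor edge
  field
    eu  : Fin n
    ev  : Fin n
    elt : toℕ eu < toℕ ev
    ead : T (adj G eu ev)

SubV : ∀ {n} → FinGraph n → Set
SubV {n} G = Fin n ⊎ (Edge G × Fin 3)

data Link {n} (G : FinGraph n) : SubV G → SubV G → Set where
  l-start : ∀ (e : Edge G) →
            Link G (inj₁ (Edge.eu e)) (inj₂ (e , Fin.zero))
  l-01    : ∀ (e : Edge G) →
            Link G (inj₂ (e , Fin.zero)) (inj₂ (e , Fin.suc Fin.zero))
  l-12    : ∀ (e : Edge G) →
            Link G (inj₂ (e , Fin.suc Fin.zero)) (inj₂ (e , Fin.suc (Fin.suc Fin.zero)))
  l-end   : ∀ (e : Edge G) →
            Link G (inj₂ (e , Fin.suc (Fin.suc Fin.zero))) (inj₁ (Edge.ev e))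

Link-irr : ∀ {n} {G : FinGraph n} {x} → ¬ Link G x x
Link-irr ()

subdivide : ∀ {n} → FinGraph n → Graph
subdivide G = record
  { V = SubV G
  ; Adj = λ x y → Link G x y ⊎ Link G y x
  ; sym = λ { (inj₁ p) → inj₂ p ; (inj₂ p) → inj₁ p }
  ; irrefl = λ { (inj₁ p) → Link-irr p ; (inj₂ p) → Link-irr p }
  }

-- A graph is a yes-instance iff some minimum dominating set contains two adjacent
-- vertices: contracting such an edge saves a vertex, and conversely a dominating set
-- of a contraction lifts back with one extra vertex, which can be chosen adjacent to
-- another vertex of the lifted set.  Subdividing every edge of G three times raises
-- the domination number by exactly the number m of edges: a dominating set of G
-- extends by one inner vertex per edge, and a dominating set of G′ meets the inner
-- path of every edge (its middle vertex is covered), so keeping one such vertex per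
-- edge and sending the others to an end of their edge leaves a dominating set of G
-- with m fewer vertices.  Adjacent vertices survive both ways: an edge uv inside D
-- gives u with its neighbouring inner vertex, and a dominating set of G′ containing
-- two adjacent vertices can be exchanged, one vertex at a time, into one of no
-- larger size containing both ends of an edge of G, which are kept by the projection.

module Submission where

open import Defs
open import Data.Nat using (ℕ; suc; _+_; _≤_; s≤s; z≤n; s≤s⁻¹; _<?_)
open import Data.Nat.Properties
  using (≤-refl; ≤-reflexive; ≤-trans; ≤-antisym; n≮n; +-comm; +-suc; +-monoˡ-≤; +-monoʳ-≤;
         +-cancelʳ-≤; <-irrelevant; <-cmp; module ≤-Reasoning)
open import Data.Fin using (Fin; toℕ; zero; suc)
import Data.Fin.Properties as Fin
open import Data.Bool.Properties using (T?; T-irrelevant)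
open import Data.Maybe using (Maybe; just; nothing)
open import Data.Product using (Σ; Σ-syntax; ∃-syntax; _×_; _,_; proj₁; proj₂)
open import Data.Product.Properties using () renaming (≡-dec to ×-≡-dec)
open import Data.Sum using (_⊎_; inj₁; inj₂)
open import Data.Sum.Properties using () renaming (≡-dec to ⊎-≡-dec)
open import Data.Empty using (⊥; ⊥-elim)
open import Data.List using (List; []; _∷_; length; map; filter; mapMaybe; _++_; cartesianProduct; allFin)
open import Data.List.Properties using (length-map; length-++; length-filter; filter-notAll)
open import Data.List.Membership.Propositional using (_∈_; _∉_)
open import Data.List.Membership.Propositional.Properties
  using (∈-map⁺; ∈-map⁻; ∈-filter⁺; ∈-∃++; ∈-++⁻; ∈-++⁺ˡ; ∈-++⁺ʳ; ∈-cartesianProduct⁺; ∈-allFin)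
import Data.List.Membership.DecPropositional as DecMembership
open import Data.List.Relation.Unary.Any using (here; there)
import Data.List.Relation.Unary.Any as Any
import Data.List.Relation.Unary.All as All
open import Data.List.Relation.Unary.AllPairs using ([]; _∷_)
open import Data.List.Relation.Unary.Unique.Propositional using (Unique)
open import Data.List.Relation.Unary.Unique.Propositional.Properties using (allFin⁺; cartesianProduct⁺; map⁺)
open import Data.List.Relation.Binary.Subset.Propositional using (_⊆_)
open import Function.Bundles using (_⇔_; mk⇔)
open import Function.Construct.Composition using (_⇔-∘_)
open import Function.Construct.Symmetry using (⇔-sym)
open import Relation.Nullary using (¬_; Dec; yes; no; ¬?)
open import Relation.Nullary.Decidable using (False; map′; fromWitnessFalse; toWitnessFalse)
open import Relation.Unary using (Decidable)
open import Relation.Binary.Definitions using (DecidableEquality; tri<; tri≈; tri>)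
open import Relation.Binary.PropositionalEquality
  using (_≡_; _≢_; refl; trans; cong; cong₂; subst) renaming (sym to ≡-sym)

module _ {A B : Set} (g : A → Maybe B) where

  ∈-mapMaybe⁺ : ∀ {a b xs} → g a ≡ just b → a ∈ xs → b ∈ mapMaybe g xs
  ∈-mapMaybe⁺ {xs = x ∷ xs} ga≡b (here refl) rewrite ga≡b = here refl
  ∈-mapMaybe⁺ {xs = x ∷ xs} ga≡b (there a∈) with g x
  ... | just _  = there (∈-mapMaybe⁺ ga≡b a∈)
  ... | nothing = ∈-mapMaybe⁺ ga≡b a∈

  ∈-mapMaybe⁻ : ∀ {b} xs → b ∈ mapMaybe g xs → ∃[ a ] (a ∈ xs × g a ≡ just b)
  ∈-mapMaybe⁻ (x ∷ xs) b∈ with g x in gx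
  ∈-mapMaybe⁻ (x ∷ xs) (here refl) | just _ = x , here refl , gx
  ∈-mapMaybe⁻ (x ∷ xs) (there b∈)  | just _ with ∈-mapMaybe⁻ xs b∈
  ... | a , a∈ , ga = a , there a∈ , ga
  ∈-mapMaybe⁻ (x ∷ xs) b∈ | nothing with ∈-mapMaybe⁻ xs b∈
  ... | a , a∈ , ga = a , there a∈ , ga

  mapMaybe-unique : (∀ {a a′ b} → g a ≡ just b → g a′ ≡ just b → a ≡ a′) →
                    ∀ {xs} → Unique xs → Unique (mapMaybe g xs)
  mapMaybe-unique injective {[]} [] = []
  mapMaybe-unique injective {x ∷ xs} (x∉ ∷ unique) with g x in gx
  ... | just b  = All.tabulate fresh ∷ mapMaybe-unique injective unique
    where
    fresh : ∀ {b′} → b′ ∈ mapMaybe g xs → b ≢ b′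
    fresh b′∈ refl with ∈-mapMaybe⁻ xs b′∈
    ... | a , a∈ , ga = All.lookup x∉ a∈ (injective gx ga)
  ... | nothing = mapMaybe-unique injective unique

module _ {A : Set} where

  Unique-⊆⇒length≤ : ∀ {xs ys : List A} → Unique xs → xs ⊆ ys → length xs ≤ length ys
  Unique-⊆⇒length≤ {[]} _ _ = z≤n
  Unique-⊆⇒length≤ {x ∷ xs} (x∉ ∷ unique) xs⊆ys with ∈-∃++ (xs⊆ys (here refl))
  ... | ys₁ , ys₂ , refl = begin
    suc (length xs)             ≤⟨ s≤s (Unique-⊆⇒length≤ unique xs⊆rest) ⟩
    suc (length (ys₁ ++ ys₂))   ≡⟨ cong suc (length-++ ys₁) ⟩
    suc (length ys₁ + length ys₂) ≡⟨ +-suc (length ys₁) (length ys₂) ⟨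
    length ys₁ + suc (length ys₂) ≡⟨ length-++ ys₁ ⟨
    length (ys₁ ++ x ∷ ys₂)     ∎
    where
    open ≤-Reasoning
    xs⊆rest : xs ⊆ ys₁ ++ ys₂
    xs⊆rest {z} z∈ with ∈-++⁻ ys₁ (xs⊆ys (there z∈))
    ... | inj₁ z∈ys₁          = ∈-++⁺ˡ z∈ys₁
    ... | inj₂ (here refl)    = ⊥-elim (All.lookup x∉ z∈ refl)
    ... | inj₂ (there z∈ys₂)  = ∈-++⁺ʳ ys₁ z∈ys₂

  length-filter-¬ : ∀ {P : A → Set} (P? : Decidable P) xs →
                    length (filter (λ x → ¬? (P? x)) xs) + length (filter P? xs) ≡ length xs
  length-filter-¬ P? [] = refl
  length-filter-¬ P? (x ∷ xs) with P? x
  ... | yes _ = trans (+-suc _ _) (cong suc (length-filter-¬ P? xs))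
  ... | no _  = cong suc (length-filter-¬ P? xs)

Covers : (K : Graph) → V K → V K → Set
Covers K u v = u ≡ v ⊎ Adj K v u

covered : ∀ {K D} → Dominating K D → ∀ v → ∃[ u ] (u ∈ D × Covers K u v)
covered dom v with dom v
... | inj₁ v∈ = v , v∈ , inj₁ refl
... | inj₂ (u , u∈ , vu) = u , u∈ , inj₂ vu

covers⇒dominating : ∀ {K D} → (∀ v → ∃[ u ] (u ∈ D × Covers K u v)) → Dominating K D
covers⇒dominating cover v with cover v
... | _ , u∈ , inj₁ refl = inj₁ u∈
... | u , u∈ , inj₂ vu = inj₂ (u , u∈ , vu)

adjacent-distinct : ∀ {K x y} → Adj K x y → x ≢ y
adjacent-distinct {K} xy refl = irrefl K xy

ContainsEdge : (K : Graph) → List (V K) → Set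
ContainsEdge K D = ∃[ a ] ∃[ b ] (a ∈ D × b ∈ D × Adj K a b)

MinimumDominatingSetWithEdge : Graph → Set
MinimumDominatingSetWithEdge K =
  ∃[ k ] (DomNum K k × ∃[ D ] (Dominating K D × length D ≤ k × ContainsEdge K D))

module _ (K : Graph) (_≟_ : DecidableEquality (V K)) where

  record Exchange (D : List (V K)) (w w′ : V K) : Set where
    field
      result     : List (V K)
      dominating : Dominating K result
      shorter    : length result ≤ length D
      new∈       : w′ ∈ result
      keeps      : ∀ {u} → u ∈ D → u ≢ w → u ∈ result

  exchange : ∀ {D w w′} → Dominating K D → w ∈ D →
             (∀ v → Covers K w v → ∃[ u ] ((u ≡ w′ ⊎ (u ∈ D × u ≢ w)) × Covers K u v)) →
             Exchange D w w′
  exchange {D} {w} {w′} dom w∈ cover-around-w = record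
    { result     = w′ ∷ filter ≢w? D
    ; dominating = covers⇒dominating {K} cover
    ; shorter    = filter-notAll ≢w? D (Any.map (λ w≡u u≢w → u≢w (≡-sym w≡u)) w∈)
    ; new∈       = here refl
    ; keeps      = keeps
    }
    where
    ≢w? : ∀ u → Dec (u ≢ w)
    ≢w? u = ¬? (u ≟ w)
    keeps : ∀ {u} → u ∈ D → u ≢ w → u ∈ w′ ∷ filter ≢w? D
    keeps u∈ u≢w = there (∈-filter⁺ ≢w? u∈ u≢w)
    cover : ∀ v → ∃[ u ] (u ∈ w′ ∷ filter ≢w? D × Covers K u v)
    cover v with covered {K} dom v
    ... | u , u∈ , uv with u ≟ w
    ... | no u≢w = u , keeps u∈ u≢w , uv
    ... | yes refl with cover-around-w v uv
    ...   | u′ , inj₁ refl , u′v = u′ , here refl , u′v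
    ...   | u′ , inj₂ (u′∈ , u′≢w) , u′v = u′ , keeps u′∈ u′≢w , u′v

module Contraction {K : Graph} (_≟_ : DecidableEquality (V K)) {x y : V K} (xy : Adj K x y)
                   {H : Graph} {f : V K → V H} (contraction : IsContraction K x y H f) where
  open IsContraction contraction

  Merged : V K → Set
  Merged a = a ≡ x ⊎ a ≡ y

  merged? : ∀ a → Dec (Merged a)
  merged? a with a ≟ x | a ≟ y
  ... | yes a≡x | _       = yes (inj₁ a≡x)
  ... | no _    | yes a≡y = yes (inj₂ a≡y)
  ... | no a≢x  | no a≢y  = no λ { (inj₁ a≡x) → a≢x a≡x ; (inj₂ a≡y) → a≢y a≡y }

  merged-image : ∀ {a} → Merged a → f a ≡ f x
  merged-image (inj₁ refl) = refl
  merged-image (inj₂ refl) = ≡-sym merge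

  image-merged : ∀ {a} → f a ≡ f x → Merged a
  image-merged {a} fa≡fx with onlyxy a x fa≡fx
  ... | inj₁ a≡x       = inj₁ a≡x
  ... | inj₂ (Ma , _) = Ma

  injective-outside : ∀ {a b} → ¬ Merged a → f a ≡ f b → a ≡ b
  injective-outside {a} {b} ¬Ma fa≡fb with onlyxy a b fa≡fb
  ... | inj₁ a≡b       = a≡b
  ... | inj₂ (Ma , _) = ⊥-elim (¬Ma Ma)

  merged-covers : ∀ {a v} → Merged a → Merged v → Covers K a v
  merged-covers (inj₁ refl) (inj₁ refl) = inj₁ refl
  merged-covers (inj₁ refl) (inj₂ refl) = inj₂ (sym K xy)
  merged-covers (inj₂ refl) (inj₁ refl) = inj₂ xy
  merged-covers (inj₂ refl) (inj₂ refl) = inj₁ refl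

  preimage : V H → V K
  preimage p = proj₁ (surj p)

  preimage-image : ∀ p → f (preimage p) ≡ p
  preimage-image p = proj₂ (surj p)

  _≟H_ : DecidableEquality (V H)
  p ≟H q with merged? (preimage p) | merged? (preimage q)
  ... | yes Mp | yes Mq = yes (trans (image p Mp) (≡-sym (image q Mq)))
    where
    image : ∀ r → Merged (preimage r) → r ≡ f x
    image r M = trans (≡-sym (preimage-image r)) (merged-image M)
  ... | yes Mp | no ¬Mq = no λ p≡q → ¬Mq (image-merged
          (trans (preimage-image q) (trans (≡-sym p≡q)
            (trans (≡-sym (preimage-image p)) (merged-image Mp)))))
  ... | no ¬Mp | _ = map′
          (λ e → trans (≡-sym (preimage-image p)) (trans (cong f e) (preimage-image q)))
          (λ p≡q → injective-outside ¬Mp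
             (trans (preimage-image p) (trans p≡q (≡-sym (preimage-image q)))))
          (preimage p ≟ preimage q)

  ≢fx? : ∀ p → Dec (p ≢ f x)
  ≢fx? p = ¬? (p ≟H f x)

  unmerged : List (V H) → List (V K)
  unmerged DH = map preimage (filter ≢fx? DH)

  unmerged-∈ : ∀ {DH b p} → p ∈ DH → f b ≡ p → ¬ Merged b → b ∈ unmerged DH
  unmerged-∈ {DH} {b} {p} p∈ fb≡p ¬Mb =
    subst (_∈ unmerged DH)
      (≡-sym (injective-outside ¬Mb (trans fb≡p (≡-sym (preimage-image p)))))
      (∈-map⁺ preimage (∈-filter⁺ ≢fx? p∈
        λ p≡fx → ¬Mb (image-merged (trans fb≡p p≡fx))))

  reflect-cover : ∀ {p v} → ¬ Merged v → Covers H p (f v) → ∃[ b ] (f b ≡ p × Covers K b v)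
  reflect-cover {v = v} _ (inj₁ p≡fv) = v , ≡-sym p≡fv , inj₁ refl
  reflect-cover ¬Mv (inj₂ adj) with adj→ _ _ adj
  ... | _ , a , b , fa≡fv , fb≡p , ab with injective-outside ¬Mv (≡-sym fa≡fv)
  ... | refl = b , fb≡p , inj₂ ab

  pull-cover : ∀ {DH v} → Dominating H DH → ¬ Merged v →
               ∃[ b ] (Covers K b v × ((f x ∈ DH × Merged b) ⊎ b ∈ unmerged DH))
  pull-cover {DH} domH ¬Mv with covered {H} domH (f _)
  ... | p , p∈ , cover with reflect-cover ¬Mv cover
  ... | b , fb≡p , bv with merged? b
  ... | yes Mb = b , bv , inj₁ (subst (_∈ DH) (trans (≡-sym fb≡p) (merged-image Mb)) p∈ , Mb)
  ... | no ¬Mb = b , bv , inj₂ (unmerged-∈ p∈ fb≡p ¬Mb)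

  Lifted : List (V H) → Set
  Lifted DH = ∃[ DK ] (Dominating K DK × length DK ≤ suc (length DH) × ContainsEdge K DK)

  lift-containing-merged : ∀ {DH} → Dominating H DH → f x ∈ DH → Lifted DH
  lift-containing-merged {DH} domH fx∈ =
    x ∷ y ∷ unmerged DH , covers⇒dominating {K} cover , s≤s shorter ,
    x , y , here refl , there (here refl) , xy
    where
    shorter : suc (length (unmerged DH)) ≤ length DH
    shorter = subst (λ l → suc l ≤ length DH) (≡-sym (length-map preimage (filter ≢fx? DH)))
                (filter-notAll ≢fx? DH (Any.map (λ fx≡p p≢fx → p≢fx (≡-sym fx≡p)) fx∈))
    merged-∈ : ∀ {b} → Merged b → b ∈ x ∷ y ∷ unmerged DH
    merged-∈ (inj₁ refl) = here refl
    merged-∈ (inj₂ refl) = there (here refl)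
    cover : ∀ v → ∃[ u ] (u ∈ x ∷ y ∷ unmerged DH × Covers K u v)
    cover v with merged? v
    ... | yes Mv = x , here refl , merged-covers (inj₁ refl) Mv
    ... | no ¬Mv with pull-cover domH ¬Mv
    ...   | b , bv , inj₁ (_ , Mb) = b , merged-∈ Mb , bv
    ...   | b , bv , inj₂ b∈ = b , there (there b∈) , bv

  lift-avoiding-merged : ∀ {DH} → Dominating H DH → f x ∉ DH → Lifted DH
  lift-avoiding-merged {DH} domH fx∉ with covered {H} domH (f x)
  ... | p , p∈ , inj₁ refl = ⊥-elim (fx∉ p∈)
  ... | p , p∈ , inj₂ adj with adj→ (f x) p adj
  ...   | _ , a , b , fa≡fx , fb≡p , ab =
    a ∷ unmerged DH , covers⇒dominating {K} cover , s≤s shorter ,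
    a , b , here refl , there (unmerged-∈ p∈ fb≡p ¬Mb) , ab
    where
    ¬Mb : ¬ Merged b
    ¬Mb Mb = fx∉ (subst (_∈ DH) (trans (≡-sym fb≡p) (merged-image Mb)) p∈)
    shorter : length (unmerged DH) ≤ length DH
    shorter = subst (_≤ length DH) (≡-sym (length-map preimage (filter ≢fx? DH))) (length-filter ≢fx? DH)
    cover : ∀ v → ∃[ u ] (u ∈ a ∷ unmerged DH × Covers K u v)
    cover v with merged? v
    ... | yes Mv = a , here refl , merged-covers (image-merged fa≡fx) Mv
    ... | no ¬Mv with pull-cover domH ¬Mv
    ...   | _ , _ , inj₁ (fx∈ , _) = ⊥-elim (fx∉ fx∈)
    ...   | b′ , b′v , inj₂ b′∈ = b′ , there b′∈ , b′v

  lift-dominating : ∀ DH → Dominating H DH → Lifted DH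
  lift-dominating DH domH with DecMembership._∈?_ _≟H_ (f x) DH
  ... | yes fx∈ = lift-containing-merged domH fx∈
  ... | no fx∉  = lift-avoiding-merged domH fx∉

  push-dominating : ∀ D → Dominating K D → x ∈ D → y ∈ D →
                    ∃[ DH ] (Dominating H DH × suc (length DH) ≤ length D)
  push-dominating D dom x∈ y∈ = map f (filter ≢y? D) , covers⇒dominating {H} cover , shorter
    where
    ≢y? : ∀ a → Dec (a ≢ y)
    ≢y? a = ¬? (a ≟ y)
    shorter : suc (length (map f (filter ≢y? D))) ≤ length D
    shorter = subst (λ l → suc l ≤ length D) (≡-sym (length-map f (filter ≢y? D)))
                (filter-notAll ≢y? D (Any.map (λ y≡a a≢y → a≢y (≡-sym y≡a)) y∈))
    image-∈ : ∀ {u} → u ∈ D → f u ∈ map f (filter ≢y? D)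
    image-∈ {u} u∈ with u ≟ y
    ... | yes refl = subst (_∈ map f (filter ≢y? D)) merge
                       (∈-map⁺ f (∈-filter⁺ ≢y? x∈ (adjacent-distinct {K} xy)))
    ... | no u≢y = ∈-map⁺ f (∈-filter⁺ ≢y? u∈ u≢y)
    push-cover : ∀ {u v} → Covers K u v → Covers H (f u) (f v)
    push-cover {u} {v} uv with f u ≟H f v
    ... | yes fu≡fv = inj₁ fu≡fv
    ... | no fu≢fv with uv
    ...   | inj₁ refl = ⊥-elim (fu≢fv refl)
    ...   | inj₂ vu = inj₂ (adj← (f v) (f u) (λ e → fu≢fv (≡-sym e)) (v , u , refl , refl , vu))
    cover : ∀ p → ∃[ q ] (q ∈ map f (filter ≢y? D) × Covers H q p)
    cover p with surj p
    ... | v , refl with covered {K} dom v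
    ...   | u , u∈ , uv = f u , image-∈ u∈ , push-cover uv

module _ {K : Graph} (_≟_ : DecidableEquality (V K)) {x y : V K} (xy : Adj K x y) where

  private
    -- the contracted graph keeps every vertex but y, and x stands for the merged vertex
    Remaining : Set
    Remaining = Σ[ a ∈ V K ] False (a ≟ y)

    remaining-≡ : ∀ {p q : Remaining} → proj₁ p ≡ proj₁ q → p ≡ q
    remaining-≡ {a , _} {.a , _} refl = cong (a ,_) (T-irrelevant _ _)

    merge′ : ∀ a → Dec (a ≡ y) → Remaining
    merge′ a (yes _)  = x , fromWitnessFalse (adjacent-distinct {K} xy)
    merge′ a (no a≢y) = a , fromWitnessFalse a≢y

    mergeMap : V K → Remaining
    mergeMap a = merge′ a (a ≟ y)

    mergeMap-cases : ∀ a → (a ≡ y × proj₁ (mergeMap a) ≡ x) ⊎ (a ≢ y × proj₁ (mergeMap a) ≡ a)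
    mergeMap-cases a with a ≟ y
    ... | yes a≡y = inj₁ (a≡y , refl)
    ... | no a≢y  = inj₂ (a≢y , refl)

    mergeMap-x : proj₁ (mergeMap x) ≡ x
    mergeMap-x with mergeMap-cases x
    ... | inj₁ (x≡y , _) = ⊥-elim (adjacent-distinct {K} xy x≡y)
    ... | inj₂ (_ , e)   = e

    mergeMap-y : proj₁ (mergeMap y) ≡ x
    mergeMap-y with mergeMap-cases y
    ... | inj₁ (_ , e)   = e
    ... | inj₂ (y≢y , _) = ⊥-elim (y≢y refl)

    AdjRemaining : Remaining → Remaining → Set
    AdjRemaining p q = p ≢ q × ∃[ a ] ∃[ b ] (mergeMap a ≡ p × mergeMap b ≡ q × Adj K a b)

    Contracted : Graph
    Contracted = record
      { V      = Remaining
      ; Adj    = AdjRemaining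
      ; sym    = λ { (p≢q , a , b , ap , bq , ab) → (λ e → p≢q (≡-sym e)) , b , a , bq , ap , sym K ab }
      ; irrefl = λ { (p≢p , _) → p≢p refl }
      }

    surjective : ∀ p → ∃[ a ] (mergeMap a ≡ p)
    surjective (a , a≢y) with mergeMap-cases a
    ... | inj₁ (a≡y , _) = ⊥-elim (toWitnessFalse a≢y a≡y)
    ... | inj₂ (_ , e)   = a , remaining-≡ e

    only-xy : ∀ a b → mergeMap a ≡ mergeMap b → a ≡ b ⊎ ((a ≡ x ⊎ a ≡ y) × (b ≡ x ⊎ b ≡ y))
    only-xy a b e with mergeMap-cases a | mergeMap-cases b | cong proj₁ e
    ... | inj₁ (a≡y , _)  | inj₁ (b≡y , _)  | _ = inj₂ (inj₂ a≡y , inj₂ b≡y)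
    ... | inj₁ (a≡y , ea) | inj₂ (_ , eb)   | e₁ =
      inj₂ (inj₂ a≡y , inj₁ (trans (≡-sym eb) (trans (≡-sym e₁) ea)))
    ... | inj₂ (_ , ea)   | inj₁ (b≡y , eb) | e₁ =
      inj₂ (inj₁ (trans (≡-sym ea) (trans e₁ eb)) , inj₂ b≡y)
    ... | inj₂ (_ , ea)   | inj₂ (_ , eb)   | e₁ = inj₁ (trans (≡-sym ea) (trans e₁ eb))

  contract : Σ Graph λ H → Σ (V K → V H) (IsContraction K x y H)
  contract = Contracted , mergeMap , record
    { surj   = surjective
    ; merge  = remaining-≡ (trans mergeMap-x (≡-sym mergeMap-y))
    ; onlyxy = only-xy
    ; adj→   = λ _ _ adj → adj
    ; adj←   = λ _ _ p≢q pq → p≢q , pq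
    }

yesInstance⇔minimumDominatingSetWithEdge :
  ∀ {K} → DecidableEquality (V K) → YesInstance K ⇔ MinimumDominatingSetWithEdge K
yesInstance⇔minimumDominatingSetWithEdge {K} _≟_ = mk⇔ to from
  where
  to : YesInstance K → MinimumDominatingSetWithEdge K
  to (inj₁ (k , _ , k<k)) = ⊥-elim (n≮n k k<k)
  to (inj₂ (x , y , xy , H , f , c , k , k′ , γk , ((DH , domH , refl) , _) , k′+1≤k))
    with Contraction.lift-dominating _≟_ xy c DH domH
  ... | DK , domK , DK≤ , DK-edge =
    k , γk , DK , domK , ≤-trans DK≤ (subst (_≤ k) (+-comm (length DH) 1) k′+1≤k) , DK-edge

  from : MinimumDominatingSetWithEdge K → YesInstance K
  from (k , γk , D , domD , D≤k , x , y , x∈ , y∈ , xy) with contract _≟_ xy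
  ... | H , f , c with Contraction.push-dominating _≟_ xy c D domD x∈ y∈
  ...   | DH , domH , DH<D =
    inj₂ (x , y , xy , H , f , c , k , length DH , γk , ((DH , domH , refl) , minimal) ,
          subst (_≤ k) (+-comm 1 (length DH)) (≤-trans DH<D D≤k))
    where
    minimal : ∀ DH′ → Dominating H DH′ → length DH ≤ length DH′
    minimal DH′ domH′ with Contraction.lift-dominating _≟_ xy c DH′ domH′
    ... | DK , domK , DK≤ , _ =
      s≤s⁻¹ (≤-trans (≤-trans DH<D D≤k) (≤-trans (proj₂ γk DK domK) DK≤))

record DominationOffset (K L : Graph) (m : ℕ) : Set₁ where
  field
    up       : ∀ D → Dominating K D →
               ∃[ D′ ] (Dominating L D′ × length D′ ≤ length D + m ×
                        (ContainsEdge K D → ContainsEdge L D′))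
    down     : ∀ D′ → Dominating L D′ → ∃[ D ] (Dominating K D × length D + m ≤ length D′)
    downEdge : ∀ D′ → Dominating L D′ → ContainsEdge L D′ →
               ∃[ D ] (Dominating K D × length D + m ≤ length D′ × ContainsEdge K D)

module _ {K L m} (offset : DominationOffset K L m) where
  open DominationOffset offset

  domNum-offset : ∀ {k} → DomNum K k → DomNum L (k + m)
  domNum-offset ((D , domD , refl) , minimal) with up D domD
  ... | D′ , domD′ , D′≤ , _ = (D′ , domD′ , ≤-antisym D′≤ (lower D′ domD′)) , lower
    where
    lower : ∀ E′ → Dominating L E′ → length D + m ≤ length E′
    lower E′ domE′ with down E′ domE′
    ... | E , domE , E≤ = ≤-trans (+-monoˡ-≤ m (minimal E domE)) E≤

  minimumDominatingSetWithEdge-offset :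
    MinimumDominatingSetWithEdge K ⇔ MinimumDominatingSetWithEdge L
  minimumDominatingSetWithEdge-offset = mk⇔ to from
    where
    to : MinimumDominatingSetWithEdge K → MinimumDominatingSetWithEdge L
    to (k , γk , D , domD , D≤k , edgeD) with up D domD
    ... | D′ , domD′ , D′≤ , preserve =
      k + m , domNum-offset γk , D′ , domD′ , ≤-trans D′≤ (+-monoˡ-≤ m D≤k) , preserve edgeD

    from : MinimumDominatingSetWithEdge L → MinimumDominatingSetWithEdge K
    from (k′ , ((W′ , domW′ , refl) , minimal′) , D′ , domD′ , D′≤k′ , edgeD′)
      with down W′ domW′ | downEdge D′ domD′ edgeD′
    ... | W , domW , W≤ | D , domD , D≤ , edgeD =
      length W , ((W , domW , refl) , minimal) , D , domD ,
      +-cancelʳ-≤ m _ _ (≤-trans D≤ (≤-trans D′≤k′ (W′≤ W domW))) , edgeD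
      where
      W′≤ : ∀ E → Dominating K E → length W′ ≤ length E + m
      W′≤ E domE with up E domE
      ... | E′ , domE′ , E′≤ , _ = ≤-trans (minimal′ E′ domE′) E′≤
      minimal : ∀ E → Dominating K E → length W ≤ length E
      minimal E domE = +-cancelʳ-≤ m _ _ (≤-trans W≤ (W′≤ E domE))

module Subdivision {n : ℕ} (G : FinGraph n) where

  G₀ G′ : Graph
  G₀ = toGraph G
  G′ = subdivide G

  open Edge

  ends : Edge G → Fin n × Fin n
  ends e = eu e , ev e

  ends-injective : ∀ {e e′} → ends e ≡ ends e′ → e ≡ e′
  ends-injective {edge u v _ _} {edge .u .v _ _} refl =
    cong₂ (edge u v) (<-irrelevant _ _) (T-irrelevant _ _)

  _≟E_ : DecidableEquality (Edge G)
  e ≟E e′ = map′ ends-injective (cong ends) (×-≡-dec Fin._≟_ Fin._≟_ (ends e) (ends e′))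

  _≟V_ : DecidableEquality (SubV G)
  _≟V_ = ⊎-≡-dec Fin._≟_ (×-≡-dec _≟E_ Fin._≟_)

  toEdge : Fin n × Fin n → Maybe (Edge G)
  toEdge (u , v) with toℕ u <? toℕ v | T? (adj G u v)
  ... | yes u<v | yes uv = just (edge u v u<v uv)
  ... | _       | _      = nothing

  toEdge-ends : ∀ e → toEdge (ends e) ≡ just e
  toEdge-ends e with toℕ (eu e) <? toℕ (ev e) | T? (adj G (eu e) (ev e))
  ... | yes _   | yes _  = cong just (ends-injective refl)
  ... | no u≮v  | _      = ⊥-elim (u≮v (elt e))
  ... | yes _   | no ¬uv = ⊥-elim (¬uv (ead e))

  toEdge-sound : ∀ {p e} → toEdge p ≡ just e → ends e ≡ p
  toEdge-sound {u , v} eq with toℕ u <? toℕ v | T? (adj G u v)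
  toEdge-sound refl | yes _ | yes _ = refl
  toEdge-sound ()   | yes _ | no _
  toEdge-sound ()   | no _  | _

  edges : List (Edge G)
  edges = mapMaybe toEdge (cartesianProduct (allFin n) (allFin n))

  edges-complete : ∀ e → e ∈ edges
  edges-complete e = ∈-mapMaybe⁺ toEdge (toEdge-ends e) (∈-cartesianProduct⁺ (∈-allFin _) (∈-allFin _))

  edges-unique : Unique edges
  edges-unique = mapMaybe-unique toEdge
    (λ p↦e q↦e → trans (≡-sym (toEdge-sound p↦e)) (toEdge-sound q↦e))
    (cartesianProduct⁺ (allFin⁺ n) (allFin⁺ n))

  m : ℕ
  m = length edges

  -- a view on the ends of an edge, so that arguments about the path
  -- eu e , (e , 0) , (e , 1) , (e , 2) , ev e are made once for both directions
  data End (e : Edge G) : Fin n → Set where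
    source : End e (eu e)
    target : End e (ev e)

  module _ {e : Edge G} where

    near : ∀ {x} → End e x → Fin 3
    near source = zero
    near target = suc (suc zero)

    other : ∀ {x} → End e x → Fin n
    other {.(eu e)} source = ev e
    other {.(ev e)} target = eu e

    flip : ∀ {x} (p : End e x) → End e (other p)
    flip source = target
    flip target = source

    end-adjacent : ∀ {x} (p : End e x) → Adj G₀ x (other p)
    end-adjacent source = ead e
    end-adjacent target = sym G₀ (ead e)

    ends-cover : ∀ {x y} → End e x → End e y → Covers G₀ x y
    ends-cover source source = inj₁ refl
    ends-cover source target = inj₂ (sym G₀ (ead e))
    ends-cover target source = inj₂ (ead e)
    ends-cover target target = inj₁ refl

    near≢middle : ∀ {x} (p : End e x) → near p ≢ suc zero
    near≢middle source ()
    near≢middle target ()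

    near≢far : ∀ {x} (p : End e x) → near p ≢ near (flip p)
    near≢far source ()
    near≢far target ()

    near-injective : ∀ {x y} (p : End e x) (q : End e y) → near p ≡ near q → x ≡ y
    near-injective source source _ = refl
    near-injective target target _ = refl

    vertex-near : ∀ {x} (p : End e x) → Adj G′ (inj₁ x) (inj₂ (e , near p))
    vertex-near source = inj₁ (l-start e)
    vertex-near target = inj₂ (l-end e)

    near-middle : ∀ {x} (p : End e x) → Adj G′ (inj₂ (e , near p)) (inj₂ (e , suc zero))
    near-middle source = inj₁ (l-01 e)
    near-middle target = inj₂ (l-12 e)

    near-neighbours : ∀ {x w} (p : End e x) → Adj G′ (inj₂ (e , near p)) w →
                      w ≡ inj₁ x ⊎ w ≡ inj₂ (e , suc zero)
    near-neighbours source (inj₁ (l-01 _))    = inj₂ refl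
    near-neighbours source (inj₂ (l-start _)) = inj₁ refl
    near-neighbours target (inj₁ (l-end _))   = inj₁ refl
    near-neighbours target (inj₂ (l-12 _))    = inj₂ refl

    middle-neighbours : ∀ {x w} (p : End e x) → Adj G′ (inj₂ (e , suc zero)) w →
                        w ≡ inj₂ (e , near p) ⊎ w ≡ inj₂ (e , near (flip p))
    middle-neighbours source (inj₁ (l-12 _)) = inj₂ refl
    middle-neighbours source (inj₂ (l-01 _)) = inj₁ refl
    middle-neighbours target (inj₁ (l-12 _)) = inj₁ refl
    middle-neighbours target (inj₂ (l-01 _)) = inj₂ refl

  vertex-neighbours : ∀ {x w} → Adj G′ (inj₁ x) w → ∃[ e ] Σ (End e x) λ p → w ≡ inj₂ (e , near p)
  vertex-neighbours (inj₁ (l-start e)) = e , source , refl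
  vertex-neighbours (inj₂ (l-end e))   = e , target , refl

  edge-ends : ∀ {x y} → Adj G₀ x y → ∃[ e ] Σ (End e x) λ p → other p ≡ y
  edge-ends {x} {y} xy with <-cmp (toℕ x) (toℕ y)
  ... | tri< x<y _ _ = edge x y x<y xy , source , refl
  ... | tri≈ _ x≡y _ = ⊥-elim (irrefl G₀ (subst (Adj G₀ x) (≡-sym (Fin.toℕ-injective x≡y)) xy))
  ... | tri> _ _ y<x = edge y x y<x (sym G₀ xy) , target , refl

  module Expansion (D : List (Fin n)) where

    _∈D? : ∀ x → Dec (x ∈ D)
    x ∈D? = DecMembership._∈?_ Fin._≟_ x D

    -- index 0 whenever ev e ∈ D, so that an edge inside D yields eu e next to (e , 0)
    choice : Edge G → Fin 3
    choice e with ev e ∈D? | eu e ∈D?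
    ... | yes _ | _     = zero
    ... | no _  | yes _ = suc (suc zero)
    ... | no _  | no _  = suc zero

    choice-target∈ : ∀ e → ev e ∈ D → choice e ≡ zero
    choice-target∈ e v∈ with ev e ∈D?
    ... | yes _  = refl
    ... | no v∉ = ⊥-elim (v∉ v∈)

    choice-near : ∀ {e x} (p : End e x) → x ∉ D → other p ∈ D → choice e ≡ near p
    choice-near {e} source _ v∈ = choice-target∈ e v∈
    choice-near {e} target v∉ u∈ with ev e ∈D? | eu e ∈D?
    ... | yes v∈ | _     = ⊥-elim (v∉ v∈)
    ... | no _   | yes _ = refl
    ... | no _   | no u∉ = ⊥-elim (u∉ u∈)

    choice-not-far : ∀ {e x} (p : End e x) → x ∉ D → choice e ≢ near (flip p)
    choice-not-far {e} source u∉ with ev e ∈D? | eu e ∈D?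
    ... | yes _ | _      = λ ()
    ... | no _  | yes u∈ = ⊥-elim (u∉ u∈)
    ... | no _  | no _   = λ ()
    choice-not-far {e} target v∉ with ev e ∈D? | eu e ∈D?
    ... | yes v∈ | _     = ⊥-elim (v∉ v∈)
    ... | no _   | yes _ = λ ()
    ... | no _   | no _  = λ ()

    expansion : List (SubV G)
    expansion = map inj₁ D ++ map (λ e → inj₂ (e , choice e)) edges

    expansion-length : length expansion ≡ length D + m
    expansion-length = trans (length-++ (map inj₁ D))
                             (cong₂ _+_ (length-map inj₁ D) (length-map _ edges))

    vertex∈ : ∀ {x} → x ∈ D → inj₁ x ∈ expansion
    vertex∈ x∈ = ∈-++⁺ˡ (∈-map⁺ inj₁ x∈)

    inner∈ : ∀ {e i} → choice e ≡ i → inj₂ (e , i) ∈ expansion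
    inner∈ {e} refl = ∈-++⁺ʳ (map inj₁ D) (∈-map⁺ (λ e → inj₂ (e , choice e)) (edges-complete e))

    covers-middle : ∀ e i → Covers G′ (inj₂ (e , i)) (inj₂ (e , suc zero))
    covers-middle e zero                = inj₂ (sym G′ (near-middle source))
    covers-middle e (suc zero)          = inj₁ refl
    covers-middle e (suc (suc zero))    = inj₂ (sym G′ (near-middle target))

    covers-near : ∀ {e x} i (p : End e x) → i ≢ near (flip p) →
                  Covers G′ (inj₂ (e , i)) (inj₂ (e , near p))
    covers-near zero             source _  = inj₁ refl
    covers-near (suc zero)       source _  = inj₂ (near-middle source)
    covers-near (suc (suc zero)) source i≢ = ⊥-elim (i≢ refl)
    covers-near zero             target i≢ = ⊥-elim (i≢ refl)
    covers-near (suc zero)       target _  = inj₂ (near-middle target)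
    covers-near (suc (suc zero)) target _  = inj₁ refl

    expansion-dominating : Dominating G₀ D → Dominating G′ expansion
    expansion-dominating dom = covers⇒dominating {G′} cover
      where
      cover-near : ∀ {e x} (p : End e x) → ∃[ u ] (u ∈ expansion × Covers G′ u (inj₂ (e , near p)))
      cover-near {e} {x} p with x ∈D?
      ... | yes x∈ = inj₁ x , vertex∈ x∈ , inj₂ (sym G′ (vertex-near p))
      ... | no x∉  = inj₂ (e , choice e) , inner∈ refl , covers-near (choice e) p (choice-not-far p x∉)
      cover : ∀ v → ∃[ u ] (u ∈ expansion × Covers G′ u v)
      cover (inj₁ x) with x ∈D?
      ... | yes x∈ = inj₁ x , vertex∈ x∈ , inj₁ refl
      ... | no x∉ with covered {G₀} dom x
      ...   | _ , x∈ , inj₁ refl = ⊥-elim (x∉ x∈)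
      ...   | w , w∈ , inj₂ xw with edge-ends xw
      ...     | e , p , refl = inj₂ (e , near p) , inner∈ (choice-near p x∉ w∈) , inj₂ (vertex-near p)
      cover (inj₂ (e , zero))          = cover-near source
      cover (inj₂ (e , suc zero))      = inj₂ (e , choice e) , inner∈ refl , covers-middle e (choice e)
      cover (inj₂ (e , suc (suc zero))) = cover-near target

    expansion-edge : ContainsEdge G₀ D → ContainsEdge G′ expansion
    expansion-edge (x , y , x∈ , y∈ , xy) with edge-ends xy
    ... | e , source , refl =
      inj₁ x , inj₂ (e , zero) , vertex∈ x∈ , inner∈ (choice-target∈ e y∈) , vertex-near source
    ... | e , target , refl =
      inj₁ y , inj₂ (e , zero) , vertex∈ y∈ , inner∈ (choice-target∈ e x∈) , vertex-near source

  module Shadow (D′ : List (SubV G)) (dom′ : Dominating G′ D′) where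

    -- the middle vertex of e is covered, so D′ meets the inner path of e
    representative : ∀ e → ∃[ i ] (inj₂ (e , i) ∈ D′)
    representative e with covered {G′} dom′ (inj₂ (e , suc zero))
    ... | _ , u∈ , inj₁ refl = suc zero , u∈
    ... | _ , u∈ , inj₂ adj with middle-neighbours source adj
    ...   | inj₁ refl = zero , u∈
    ...   | inj₂ refl = suc (suc zero) , u∈

    rep : Edge G → Fin 3
    rep e = proj₁ (representative e)

    IsRep : SubV G → Set
    IsRep (inj₁ _)       = ⊥
    IsRep (inj₂ (e , i)) = i ≡ rep e

    isRep? : ∀ v → Dec (IsRep v)
    isRep? (inj₁ _)       = no λ ()
    isRep? (inj₂ (e , i)) = i Fin.≟ rep e

    project : SubV G → Fin n
    project (inj₁ x)       = x
    project (inj₂ (e , _)) = eu e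

    nonRep? : ∀ v → Dec (¬ IsRep v)
    nonRep? v = ¬? (isRep? v)

    shadow : List (Fin n)
    shadow = map project (filter nonRep? D′)

    shadow-∈ : ∀ {v} → v ∈ D′ → ¬ IsRep v → project v ∈ shadow
    shadow-∈ v∈ ¬rep = ∈-map⁺ project (∈-filter⁺ nonRep? v∈ ¬rep)

    shadow-vertex : ∀ {x} → inj₁ x ∈ D′ → x ∈ shadow
    shadow-vertex x∈ = shadow-∈ x∈ λ ()

    shadow-length : length shadow + m ≤ length D′
    shadow-length = begin
      length shadow + m
        ≡⟨ cong₂ _+_ (length-map project (filter nonRep? D′)) (≡-sym (length-map repVertex edges)) ⟩
      length (filter nonRep? D′) + length (map repVertex edges)
        ≤⟨ +-monoʳ-≤ (length (filter nonRep? D′)) (Unique-⊆⇒length≤ reps-unique reps⊆) ⟩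
      length (filter nonRep? D′) + length (filter isRep? D′)
        ≡⟨ length-filter-¬ isRep? D′ ⟩
      length D′ ∎
      where
      open ≤-Reasoning
      repVertex : Edge G → SubV G
      repVertex e = inj₂ (e , rep e)
      reps-unique : Unique (map repVertex edges)
      reps-unique = map⁺ (λ { refl → refl }) edges-unique
      reps⊆ : map repVertex edges ⊆ filter isRep? D′
      reps⊆ v∈ with ∈-map⁻ repVertex v∈
      ... | e , _ , refl = ∈-filter⁺ isRep? (proj₂ (representative e)) refl

    end-covered : ∀ {e x i} → End e x → inj₂ (e , i) ∈ D′ → i ≢ rep e →
                  ∃[ u ] (u ∈ shadow × Covers G₀ u x)
    end-covered {e} p i∈ i≢rep = eu e , shadow-∈ i∈ i≢rep , ends-cover source p

    shadow-dominating : Dominating G₀ shadow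
    shadow-dominating = covers⇒dominating {G₀} cover
      where
      cover : ∀ x → ∃[ u ] (u ∈ shadow × Covers G₀ u x)
      cover x with covered {G′} dom′ (inj₁ x)
      ... | _ , x∈ , inj₁ refl = x , shadow-vertex x∈ , inj₁ refl
      ... | _ , w∈ , inj₂ adj with vertex-neighbours adj
      ...   | e , p , refl with near p Fin.≟ rep e
      ...     | no near≢rep = end-covered p w∈ near≢rep
      -- the near vertex represents e, so the far vertex is covered from elsewhere
      ...     | yes near≡rep with covered {G′} dom′ (inj₂ (e , near (flip p)))
      ...       | _ , far∈ , inj₁ refl =
        end-covered p far∈ λ far≡rep → near≢far p (trans near≡rep (≡-sym far≡rep))
      ...       | _ , u∈ , inj₂ adj′ with near-neighbours (flip p) adj′
      ...         | inj₁ refl = other p , shadow-vertex u∈ , inj₂ (end-adjacent p)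
      ...         | inj₂ refl =
        end-covered p u∈ λ mid≡rep → near≢middle p (trans near≡rep (≡-sym mid≡rep))

  BaseEdgeIn : List (SubV G) → Set
  BaseEdgeIn D′ = ∃[ x ] ∃[ y ] (inj₁ x ∈ D′ × inj₁ y ∈ D′ × Adj G₀ x y)

  WithBaseEdge : List (SubV G) → Set
  WithBaseEdge D′ = ∃[ D″ ] (Dominating G′ D″ × length D″ ≤ length D′ × BaseEdgeIn D″)

  inner-injective : ∀ {e f : Edge G} {i j} →
                    _≡_ {A = SubV G} (inj₂ (e , i)) (inj₂ (f , j)) → e ≡ f × i ≡ j
  inner-injective refl = refl , refl

  near-covered : ∀ {D′ e z} → Dominating G′ D′ → (q : End e z) →
                 inj₁ z ∈ D′ ⊎ inj₂ (e , suc zero) ∈ D′ ⊎ inj₂ (e , near q) ∈ D′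
  near-covered {e = e} dom q with covered {G′} dom (inj₂ (e , near q))
  ... | _ , u∈ , inj₁ refl = inj₂ (inj₂ u∈)
  ... | _ , u∈ , inj₂ adj with near-neighbours q adj
  ...   | inj₁ refl = inj₁ u∈
  ...   | inj₂ refl = inj₂ (inj₁ u∈)

  open Exchange

  exchanged : ∀ {D′ w w′} (E : Exchange G′ _≟V_ D′ w w′) → BaseEdgeIn (result E) → WithBaseEdge D′
  exchanged E base = result E , dominating E , shorter E , base

  replace-near : ∀ {D′ e x z} (p : End e x) → Dominating G′ D′ → inj₂ (e , near p) ∈ D′ →
                 inj₂ (e , suc zero) ∈ D′ ⊎ inj₂ (e , near (flip p)) ∈ D′ →
                 z ≡ x ⊎ inj₁ x ∈ D′ → Exchange G′ _≟V_ D′ (inj₂ (e , near p)) (inj₁ z)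
  replace-near {D′} {e} {x} {z} p dom a∈ middle-side x-side = exchange G′ _≟V_ dom a∈ cover
    where
    Candidate : SubV G → Set
    Candidate u = u ≡ inj₁ z ⊎ (u ∈ D′ × u ≢ inj₂ (e , near p))
    x-candidate : z ≡ x ⊎ inj₁ x ∈ D′ → Candidate (inj₁ x)
    x-candidate (inj₁ refl) = inj₁ refl
    x-candidate (inj₂ x∈)   = inj₂ (x∈ , λ ())
    middle-cover : inj₂ (e , suc zero) ∈ D′ ⊎ inj₂ (e , near (flip p)) ∈ D′ →
                   ∃[ u ] (Candidate u × Covers G′ u (inj₂ (e , suc zero)))
    middle-cover (inj₁ mid∈) =
      _ , inj₂ (mid∈ , λ eq → near≢middle p (≡-sym (proj₂ (inner-injective eq)))) , inj₁ refl
    middle-cover (inj₂ far∈) =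
      _ , inj₂ (far∈ , λ eq → near≢far p (≡-sym (proj₂ (inner-injective eq)))) ,
      inj₂ (sym G′ (near-middle (flip p)))
    cover : ∀ v → Covers G′ (inj₂ (e , near p)) v → ∃[ u ] (Candidate u × Covers G′ u v)
    cover _ (inj₁ refl) = inj₁ x , x-candidate x-side , inj₂ (sym G′ (vertex-near p))
    cover _ (inj₂ adj) with near-neighbours p (sym G′ adj)
    ... | inj₁ refl = inj₁ x , x-candidate x-side , inj₁ refl
    ... | inj₂ refl = middle-cover middle-side

  replace-middle : ∀ {D′ e x} (p : End e x) → Dominating G′ D′ → inj₂ (e , suc zero) ∈ D′ →
                   inj₂ (e , near p) ∈ D′ → Exchange G′ _≟V_ D′ (inj₂ (e , suc zero)) (inj₁ (other p))
  replace-middle {D′} {e} p dom mid∈ near∈ = exchange G′ _≟V_ dom mid∈ cover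
    where
    near-candidate : inj₂ (e , near p) ∈ D′ × inj₂ (e , near p) ≢ inj₂ (e , suc zero)
    near-candidate = near∈ , λ eq → near≢middle p (proj₂ (inner-injective eq))
    cover : ∀ v → Covers G′ (inj₂ (e , suc zero)) v →
            ∃[ u ] ((u ≡ inj₁ (other p) ⊎ (u ∈ D′ × u ≢ inj₂ (e , suc zero))) × Covers G′ u v)
    cover _ (inj₁ refl) = _ , inj₂ near-candidate , inj₂ (sym G′ (near-middle p))
    cover _ (inj₂ adj) with middle-neighbours p (sym G′ adj)
    ... | inj₁ refl = _ , inj₂ near-candidate , inj₁ refl
    ... | inj₂ refl = inj₁ (other p) , inj₁ refl , inj₂ (sym G′ (vertex-near (flip p)))

  _∈′?_ : ∀ v D′ → Dec (v ∈ D′)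
  v ∈′? D′ = DecMembership._∈?_ _≟V_ v D′

  vertex-and-near : ∀ {D′ e x} (p : End e x) → Dominating G′ D′ →
                    inj₁ x ∈ D′ → inj₂ (e , near p) ∈ D′ → WithBaseEdge D′
  vertex-and-near {D′} {x = x} p dom x∈ near∈ with inj₁ (other p) ∈′? D′
  ... | yes y∈ = D′ , dom , ≤-refl , x , other p , x∈ , y∈ , end-adjacent p
  ... | no y∉ with near-covered dom (flip p)
  ...   | inj₁ y∈ = ⊥-elim (y∉ y∈)
  ...   | inj₂ middle-side = let E = replace-near p dom near∈ middle-side (inj₂ x∈) in
    exchanged E (x , other p , keeps E x∈ (λ ()) , new∈ E , end-adjacent p)

  -- With x ∉ D′, look at how y = other p is covered.  If y ∈ D′, exchange the near
  -- vertex for x.  Otherwise y is covered by the near vertex w of an edge f: if the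
  -- middle of f stays covered without w, exchange w for y and then the near vertex for
  -- x; if not, the far end z of f lies in D′, and exchanging the middle of e for y
  -- gives the edge y z of G.
  near-and-middle : ∀ {D′ e x} (p : End e x) → Dominating G′ D′ →
                    inj₂ (e , near p) ∈ D′ → inj₂ (e , suc zero) ∈ D′ → WithBaseEdge D′
  near-and-middle {D′} {e} {x} p dom near∈ mid∈ with inj₁ x ∈′? D′
  ... | yes x∈ = vertex-and-near p dom x∈ near∈
  ... | no _ with covered {G′} dom (inj₁ (other p))
  ...   | _ , y∈ , inj₁ refl = let E = replace-near p dom near∈ (inj₁ mid∈) (inj₁ refl) in
    exchanged E (x , other p , new∈ E , keeps E y∈ (λ ()) , end-adjacent p)
  ...   | _ , w∈ , inj₂ adj with vertex-neighbours adj
  ...     | f , q , refl with near-covered dom (flip q)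
  ...       | inj₁ z∈ = let E = replace-middle p dom mid∈ near∈ in
    exchanged E (other p , other q , new∈ E , keeps E z∈ (λ ()) , end-adjacent q)
  ...       | inj₂ middle-side =
    result E₂ , dominating E₂ , ≤-trans (shorter E₂) (shorter E₁) ,
    x , other p , new∈ E₂ , keeps E₂ (new∈ E₁) (λ ()) , end-adjacent p
    where
    w≢near : inj₂ (f , near q) ≢ inj₂ (e , near p)
    w≢near eq with inner-injective eq
    ... | refl , nq≡np = adjacent-distinct {G₀} (end-adjacent p) (≡-sym (near-injective q p nq≡np))
    E₁ = replace-near q dom w∈ middle-side (inj₁ refl)
    E₂ = replace-near p (dominating E₁) (keeps E₁ near∈ (λ eq → w≢near (≡-sym eq)))
           (inj₁ (keeps E₁ mid∈ λ eq → near≢middle q (≡-sym (proj₂ (inner-injective eq))))) (inj₁ refl)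

  link-exchange : ∀ {D′ a b} → Dominating G′ D′ → Link G a b → a ∈ D′ → b ∈ D′ → WithBaseEdge D′
  link-exchange dom (l-start e) a∈ b∈ = vertex-and-near source dom a∈ b∈
  link-exchange dom (l-01 e)    a∈ b∈ = near-and-middle source dom a∈ b∈
  link-exchange dom (l-12 e)    a∈ b∈ = near-and-middle target dom b∈ a∈
  link-exchange dom (l-end e)   a∈ b∈ = vertex-and-near target dom b∈ a∈

  base-edge-exchange : ∀ {D′} → Dominating G′ D′ → ContainsEdge G′ D′ → WithBaseEdge D′
  base-edge-exchange dom (_ , _ , a∈ , b∈ , inj₁ link) = link-exchange dom link a∈ b∈
  base-edge-exchange dom (_ , _ , a∈ , b∈ , inj₂ link) = link-exchange dom link b∈ a∈

  subdivision-offset : DominationOffset G₀ G′ m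
  subdivision-offset = record
    { up       = λ D dom → let open Expansion D in
                 expansion , expansion-dominating dom , ≤-reflexive expansion-length , expansion-edge
    ; down     = λ D′ dom′ → let open Shadow D′ dom′ in shadow , shadow-dominating , shadow-length
    ; downEdge = downEdge
    }
    where
    downEdge : ∀ D′ → Dominating G′ D′ → ContainsEdge G′ D′ →
               ∃[ D ] (Dominating G₀ D × length D + m ≤ length D′ × ContainsEdge G₀ D)
    downEdge D′ dom′ edge′ with base-edge-exchange dom′ edge′
    ... | D″ , dom″ , D″≤ , x , y , x∈ , y∈ , xy = let open Shadow D″ dom″ in
      shadow , shadow-dominating , ≤-trans shadow-length D″≤ ,
      x , y , shadow-vertex x∈ , shadow-vertex y∈ , xy

lemma1 : ∀ (n : ℕ) (G : FinGraph n) → Connected (toGraph G) →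
           YesInstance (toGraph G) ⇔ YesInstance (subdivide G)
lemma1 n G _ =
  ⇔-sym (yesInstance⇔minimumDominatingSetWithEdge _≟V_) ⇔-∘
  (minimumDominatingSetWithEdge-offset subdivision-offset ⇔-∘
   yesInstance⇔minimumDominatingSetWithEdge Fin._≟_)
  where open Subdivision G
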